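{- Let $(M,\mathcal{X})\models\mathsf{GB}+\mathsf{SOR}$ and suppose $\mathcal{Y}\subseteq\mathcal{X}$ is definable over $(M,\mathcal{X})$ by a second-order formula, possibly with parameters. Then $(M,\mathcal{Y})\models\mathsf{SOR}$.
   Context: Models of class theory are two-sorted $(M,\mathcal{X})$ with $M$ the sets and $\mathcal{X}$ the classes. $\mathsf{GB}$: $\mathsf{ZFC}$ for sets, Class Extensionality, Class Replacement, Comprehension for formulas quantifying only over sets. $\mathsf{SOR}$: for every formula $\phi$ in the language of class theory (class quantifiers and parameters allowed), $\forall a\,[(\forall x\in a\,\exists y\,\phi(x,y))\to\exists b\,\forall x\in a\,\exists y\in b\,\phi(x,y)]$. A second-order formula may quantify over classes. -}

module Defs where

open import Data.Nat using (ℕ; suc)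
open import Data.Fin using (Fin)
open import Data.Product using (Σ; _×_; proj₁)
open import Data.Sum using (_⊎_)
open import Data.Empty using (⊥)
open import Relation.Nullary using (¬_)
open import Relation.Binary.PropositionalEquality using (_≡_)
open import Data.Vec.Functional using (_∷_)

-- Two-sorted structures (M , 𝒳) for class theory.
-- Set equality is interpreted as Agda's propositional equality.

record Structure : Set₁ where
  field
    M      : Set
    Cls    : Set
    _∈ₛ_   : M → M → Set
    _∈ᶜ_   : M → Cls → Set

open Structure public using (M; Cls)

_⇔_ : Set → Set → Set
A ⇔ B = (A → B) × (B → A)

-- Syntax of the language of class theory.
-- Formula m c : set variables Fin m, class variables Fin c (de Bruijn).
-- Class equality is not primitive (it is defined by extensionality).

data Formula (m c : ℕ) : Set where
  _∈̇_    : Fin m → Fin m → Formula m c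
  _≐_    : Fin m → Fin m → Formula m c
  _∈̇ᶜ_   : Fin m → Fin c → Formula m c
  ⊥̇      : Formula m c
  _⇒_    : Formula m c → Formula m c → Formula m c
  _∧̇_    : Formula m c → Formula m c → Formula m c
  _∨̇_    : Formula m c → Formula m c → Formula m c
  ∀ₛ ∃ₛ  : Formula (suc m) c → Formula m c
  ∀ᶜ ∃ᶜ  : Formula m (suc c) → Formula m c

data SetOnly {m c : ℕ} : Formula m c → Set where
  mem  : ∀ i j → SetOnly (i ∈̇ j)
  eq   : ∀ i j → SetOnly (i ≐ j)
  cmem : ∀ i k → SetOnly (i ∈̇ᶜ k)
  bot  : SetOnly ⊥̇
  imp  : ∀ {φ ψ} → SetOnly φ → SetOnly ψ → SetOnly (φ ⇒ ψ)
  conj : ∀ {φ ψ} → SetOnly φ → SetOnly ψ → SetOnly (φ ∧̇ ψ)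
  disj : ∀ {φ ψ} → SetOnly φ → SetOnly ψ → SetOnly (φ ∨̇ ψ)
  all  : ∀ {φ} → SetOnly {suc m} {c} φ → SetOnly (∀ₛ φ)
  ex   : ∀ {φ} → SetOnly {suc m} {c} φ → SetOnly (∃ₛ φ)

Sat : (S : Structure) {m c : ℕ} → Formula m c →
      (Fin m → M S) → (Fin c → Cls S) → Set
Sat S (i ∈̇ j)  ρ σ = Structure._∈ₛ_ S (ρ i) (ρ j)
Sat S (i ≐ j)  ρ σ = ρ i ≡ ρ j
Sat S (i ∈̇ᶜ k) ρ σ = Structure._∈ᶜ_ S (ρ i) (σ k)
Sat S ⊥̇        ρ σ = ⊥
Sat S (φ ⇒ ψ)  ρ σ = Sat S φ ρ σ → Sat S ψ ρ σ
Sat S (φ ∧̇ ψ)  ρ σ = Sat S φ ρ σ × Sat S ψ ρ σ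
Sat S (φ ∨̇ ψ)  ρ σ = Sat S φ ρ σ ⊎ Sat S ψ ρ σ
Sat S (∀ₛ φ)   ρ σ = (x : M S) → Sat S φ (x ∷ ρ) σ
Sat S (∃ₛ φ)   ρ σ = Σ (M S) λ x → Sat S φ (x ∷ ρ) σ
Sat S (∀ᶜ φ)   ρ σ = (X : Cls S) → Sat S φ ρ (X ∷ σ)
Sat S (∃ᶜ φ)   ρ σ = Σ (Cls S) λ X → Sat S φ ρ (X ∷ σ)

module Axioms (S : Structure) where
  open Structure S renaming (M to 𝕄; Cls to 𝕏)

  Extensionality : Set
  Extensionality = (x y : 𝕄) → ((z : 𝕄) → (z ∈ₛ x) ⇔ (z ∈ₛ y)) → x ≡ y

  Pairing : Set
  Pairing = (x y : 𝕄) → Σ 𝕄 λ p → (x ∈ₛ p) × (y ∈ₛ p)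

  Union : Set
  Union = (a : 𝕄) → Σ 𝕄 λ u → (z w : 𝕄) → z ∈ₛ w → w ∈ₛ a → z ∈ₛ u

  PowerSet : Set
  PowerSet = (a : 𝕄) → Σ 𝕄 λ p →
             (z : 𝕄) → ((w : 𝕄) → w ∈ₛ z → w ∈ₛ a) → z ∈ₛ p

  Infinity : Set
  Infinity = Σ 𝕄 λ ω →
    (Σ 𝕄 λ e → (e ∈ₛ ω) × ((z : 𝕄) → ¬ (z ∈ₛ e))) ×
    ((x : 𝕄) → x ∈ₛ ω → Σ 𝕄 λ s → (s ∈ₛ ω) ×
       ((z : 𝕄) → (z ∈ₛ s) ⇔ ((z ∈ₛ x) ⊎ (z ≡ x))))

  Foundation : Set
  Foundation = (a : 𝕄) → Σ 𝕄 (λ x → x ∈ₛ a) →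
    Σ 𝕄 λ x → (x ∈ₛ a) × ((z : 𝕄) → z ∈ₛ x → ¬ (z ∈ₛ a))

  Choice : Set
  Choice = (a : 𝕄) →
    ((x : 𝕄) → x ∈ₛ a → Σ 𝕄 λ z → z ∈ₛ x) →
    ((x y z : 𝕄) → x ∈ₛ a → y ∈ₛ a → z ∈ₛ x → z ∈ₛ y → x ≡ y) →
    Σ 𝕄 λ ch → (x : 𝕄) → x ∈ₛ a →
      Σ 𝕄 λ z → ((z ∈ₛ x) × (z ∈ₛ ch)) ×
                ((w : 𝕄) → w ∈ₛ x → w ∈ₛ ch → w ≡ z)

  -- Schemes of ZFC: formulas in the pure language of sets
  -- (no class variables at all), with set parameters.
  SeparationScheme : Set
  SeparationScheme = (m : ℕ) (φ : Formula (suc m) 0) → SetOnly φ →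
    (ρ : Fin m → 𝕄) (σ : Fin 0 → 𝕏) (a : 𝕄) →
    Σ 𝕄 λ b → (x : 𝕄) → (x ∈ₛ b) ⇔ ((x ∈ₛ a) × Sat S φ (x ∷ ρ) σ)

  ReplacementScheme : Set
  ReplacementScheme = (m : ℕ) (φ : Formula (suc (suc m)) 0) → SetOnly φ →
    (ρ : Fin m → 𝕄) (σ : Fin 0 → 𝕏) (a : 𝕄) →
    ((x : 𝕄) → x ∈ₛ a → Σ 𝕄 λ y → Sat S φ (y ∷ x ∷ ρ) σ ×
        ((y' : 𝕄) → Sat S φ (y' ∷ x ∷ ρ) σ → y' ≡ y)) →
    Σ 𝕄 λ b → (x : 𝕄) → x ∈ₛ a →
      Σ 𝕄 λ y → (y ∈ₛ b) × Sat S φ (y ∷ x ∷ ρ) σ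

  ZFC : Set
  ZFC = Extensionality × Pairing × Union × PowerSet × Infinity ×
        Foundation × Choice × SeparationScheme × ReplacementScheme

  ClassExtensionality : Set
  ClassExtensionality = (X Y : 𝕏) → ((z : 𝕄) → (z ∈ᶜ X) ⇔ (z ∈ᶜ Y)) → X ≡ Y

  -- p is the Kuratowski ordered pair ⟨x , y⟩ = {{x},{x,y}}.
  IsSingleton : 𝕄 → 𝕄 → Set
  IsSingleton x s = (z : 𝕄) → (z ∈ₛ s) ⇔ (z ≡ x)

  IsDoubleton : 𝕄 → 𝕄 → 𝕄 → Set
  IsDoubleton x y s = (z : 𝕄) → (z ∈ₛ s) ⇔ ((z ≡ x) ⊎ (z ≡ y))

  IsPair : 𝕄 → 𝕄 → 𝕄 → Set
  IsPair x y p = (z : 𝕄) → (z ∈ₛ p) ⇔ (IsSingleton x z ⊎ IsDoubleton x y z)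

  IsClassFunction : 𝕏 → Set
  IsClassFunction F = (x y y' p p' : 𝕄) → IsPair x y p → IsPair x y' p' →
    p ∈ᶜ F → p' ∈ᶜ F → y ≡ y'

  ClassReplacement : Set
  ClassReplacement = (F : 𝕏) → IsClassFunction F → (a : 𝕄) →
    Σ 𝕄 λ b → (y : 𝕄) → (y ∈ₛ b) ⇔
      (Σ 𝕄 λ x → (x ∈ₛ a) × Σ 𝕄 λ p → IsPair x y p × (p ∈ᶜ F))

  ElementaryComprehension : Set
  ElementaryComprehension = (m c : ℕ) (φ : Formula (suc m) c) → SetOnly φ →
    (ρ : Fin m → 𝕄) (σ : Fin c → 𝕏) →
    Σ 𝕏 λ X → (x : 𝕄) → (x ∈ᶜ X) ⇔ Sat S φ (x ∷ ρ) σ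

  GB : Set
  GB = ZFC × ClassExtensionality × ClassReplacement × ElementaryComprehension

  SOR : Set
  SOR = (m c : ℕ) (φ : Formula (suc (suc m)) c)
    (ρ : Fin m → 𝕄) (σ : Fin c → 𝕏) (a : 𝕄) →
    ((x : 𝕄) → x ∈ₛ a → Σ 𝕄 λ y → Sat S φ (y ∷ x ∷ ρ) σ) →
    Σ 𝕄 λ b → (x : 𝕄) → x ∈ₛ a →
      Σ 𝕄 λ y → (y ∈ₛ b) × Sat S φ (y ∷ x ∷ ρ) σ

open Axioms public

-- (M , 𝒴) where 𝒴 = { A ∈ 𝒳 | (M,𝒳) ⊨ ψ(A, ρ, σ) } is the collection of
-- classes defined by the second-order formula ψ with set parameters ρ
-- and class parameters σ (variable 0 of the class sort is A).

DefinedSubstructure : (S : Structure) {m c : ℕ} →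
  Formula m (suc c) → (Fin m → M S) → (Fin c → Cls S) → Structure
DefinedSubstructure S ψ ρ σ = record
  { M    = M S
  ; Cls  = Σ (Cls S) λ A → Sat S ψ ρ (A ∷ σ)
  ; _∈ₛ_ = Structure._∈ₛ_ S
  ; _∈ᶜ_ = λ x Y → Structure._∈ᶜ_ S x (proj₁ Y)
  }

-- Relativize every class quantifier of φ to ψ, producing a formula φ^𝒴 of
-- the language of (M,𝒳) whose class parameters are those of φ together
-- with those of ψ.  By induction on φ, (M,𝒴) ⊨ φ exactly when (M,𝒳) ⊨ φ^𝒴,
-- so an instance of SOR in (M,𝒴) is the instance of SOR in (M,𝒳) for φ^𝒴.
module Submission where

open import Defs
open import Data.Nat using (ℕ; suc; _+_)
open import Data.Fin using (Fin; zero; suc; _↑ˡ_; _↑ʳ_; lift)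
open import Data.Product using (Σ; _×_; _,_; proj₁; proj₂)
open import Data.Sum using (_⊎_; inj₁; inj₂)
open import Data.Vec.Functional using (Vector; _∷_; _++_)
open import Data.Vec.Functional.Properties using (lookup-++ˡ; lookup-++ʳ)
open import Function using (_∘_; id)
open import Relation.Binary.PropositionalEquality using (_≡_; refl; sym)

private
  variable
    A B : Set
    m c m′ c′ n n′ : ℕ

⇔-refl : A ⇔ A
⇔-refl = id , id

≡⇒⇔ : (P : A → B → Set) {x y : A} {u v : B} → x ≡ y → u ≡ v → P x u ⇔ P y v
≡⇒⇔ P refl refl = ⇔-refl

→-cong : {P P′ Q Q′ : Set} → P ⇔ P′ → Q ⇔ Q′ → (P → Q) ⇔ (P′ → Q′)
→-cong (f , f⁻) (g , g⁻) = (λ h → g ∘ h ∘ f⁻) , (λ h → g⁻ ∘ h ∘ f)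

×-cong : {P P′ Q Q′ : Set} → P ⇔ P′ → Q ⇔ Q′ → (P × Q) ⇔ (P′ × Q′)
×-cong (f , f⁻) (g , g⁻) = (λ (p , q) → f p , g q) , (λ (p , q) → f⁻ p , g⁻ q)

⊎-cong : {P P′ Q Q′ : Set} → P ⇔ P′ → Q ⇔ Q′ → (P ⊎ Q) ⇔ (P′ ⊎ Q′)
⊎-cong (f , f⁻) (g , g⁻) =
  (λ { (inj₁ p) → inj₁ (f p) ; (inj₂ q) → inj₂ (g q) }) ,
  (λ { (inj₁ p) → inj₁ (f⁻ p) ; (inj₂ q) → inj₂ (g⁻ q) })

Π-cong : {P Q : A → Set} → (∀ x → P x ⇔ Q x) → ((x : A) → P x) ⇔ ((x : A) → Q x)
Π-cong h = (λ p x → proj₁ (h x) (p x)) , (λ q x → proj₂ (h x) (q x))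

Σ-cong : {P Q : A → Set} → (∀ x → P x ⇔ Q x) → Σ A P ⇔ Σ A Q
Σ-cong h = (λ (x , p) → x , proj₁ (h x) p) , (λ (x , q) → x , proj₂ (h x) q)

Π-restrict-cong : {P P′ Q′ : A → Set} {Q : Σ A P → Set} →
  (∀ x → P x ⇔ P′ x) → (∀ x p → Q (x , p) ⇔ Q′ x) →
  ((y : Σ A P) → Q y) ⇔ ((x : A) → P′ x → Q′ x)
Π-restrict-cong hP hQ =
  (λ q x p′ → let p = proj₂ (hP x) p′ in proj₁ (hQ x p) (q (x , p))) ,
  (λ q (x , p) → proj₂ (hQ x p) (q x (proj₁ (hP x) p)))

Σ-restrict-cong : {P P′ Q′ : A → Set} {Q : Σ A P → Set} →
  (∀ x → P x ⇔ P′ x) → (∀ x p → Q (x , p) ⇔ Q′ x) →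
  Σ (Σ A P) Q ⇔ Σ A (λ x → P′ x × Q′ x)
Σ-restrict-cong hP hQ =
  (λ ((x , p) , q) → x , proj₁ (hP x) p , proj₁ (hQ x p) q) ,
  (λ (x , p′ , q′) → let p = proj₂ (hP x) p′ in (x , p) , proj₂ (hQ x p) q′)

rename : (Fin m → Fin m′) → (Fin c → Fin c′) → Formula m c → Formula m′ c′
rename f g (i ∈̇ j)  = f i ∈̇ f j
rename f g (i ≐ j)  = f i ≐ f j
rename f g (i ∈̇ᶜ k) = f i ∈̇ᶜ g k
rename f g ⊥̇        = ⊥̇
rename f g (φ ⇒ θ)  = rename f g φ ⇒ rename f g θ
rename f g (φ ∧̇ θ)  = rename f g φ ∧̇ rename f g θ
rename f g (φ ∨̇ θ)  = rename f g φ ∨̇ rename f g θ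
rename f g (∀ₛ φ)   = ∀ₛ (rename (lift 1 f) g φ)
rename f g (∃ₛ φ)   = ∃ₛ (rename (lift 1 f) g φ)
rename f g (∀ᶜ φ)   = ∀ᶜ (rename f (lift 1 g) φ)
rename f g (∃ᶜ φ)   = ∃ᶜ (rename f (lift 1 g) φ)

lift-∷ : (f : Fin n → Fin n′) {ρ : Vector A n} {ρ′ : Vector A n′} (x : A) →
  (∀ i → ρ′ (f i) ≡ ρ i) → ∀ i → (x ∷ ρ′) (lift 1 f i) ≡ (x ∷ ρ) i
lift-∷ f x h zero    = refl
lift-∷ f x h (suc i) = h i

Sat-rename : (S : Structure) (f : Fin m → Fin m′) (g : Fin c → Fin c′) (φ : Formula m c)
  {ρ : Vector (M S) m} {σ : Vector (Cls S) c} {ρ′ : Vector (M S) m′} {σ′ : Vector (Cls S) c′} →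
  (∀ i → ρ′ (f i) ≡ ρ i) → (∀ k → σ′ (g k) ≡ σ k) →
  Sat S φ ρ σ ⇔ Sat S (rename f g φ) ρ′ σ′
Sat-rename S f g (i ∈̇ j)  hρ hσ = ≡⇒⇔ (Structure._∈ₛ_ S) (sym (hρ i)) (sym (hρ j))
Sat-rename S f g (i ≐ j)  hρ hσ = ≡⇒⇔ _≡_ (sym (hρ i)) (sym (hρ j))
Sat-rename S f g (i ∈̇ᶜ k) hρ hσ = ≡⇒⇔ (Structure._∈ᶜ_ S) (sym (hρ i)) (sym (hσ k))
Sat-rename S f g ⊥̇        hρ hσ = ⇔-refl
Sat-rename S f g (φ ⇒ θ)  hρ hσ = →-cong (Sat-rename S f g φ hρ hσ) (Sat-rename S f g θ hρ hσ)
Sat-rename S f g (φ ∧̇ θ)  hρ hσ = ×-cong (Sat-rename S f g φ hρ hσ) (Sat-rename S f g θ hρ hσ)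
Sat-rename S f g (φ ∨̇ θ)  hρ hσ = ⊎-cong (Sat-rename S f g φ hρ hσ) (Sat-rename S f g θ hρ hσ)
Sat-rename S f g (∀ₛ φ)   hρ hσ = Π-cong λ x → Sat-rename S (lift 1 f) g φ (lift-∷ f x hρ) hσ
Sat-rename S f g (∃ₛ φ)   hρ hσ = Σ-cong λ x → Sat-rename S (lift 1 f) g φ (lift-∷ f x hρ) hσ
Sat-rename S f g (∀ᶜ φ)   hρ hσ = Π-cong λ X → Sat-rename S f (lift 1 g) φ hρ (lift-∷ g X hσ)
Sat-rename S f g (∃ᶜ φ)   hρ hσ = Σ-cong λ X → Sat-rename S f (lift 1 g) φ hρ (lift-∷ g X hσ)

Splits : Vector A (m′ + m) → Vector A m′ → Vector A m → Set
Splits {m′ = m′} {m} ρ″ ρ′ ρ = (∀ i → ρ″ (i ↑ˡ m) ≡ ρ′ i) × (∀ j → ρ″ (m′ ↑ʳ j) ≡ ρ j)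

++-Splits : (ρ′ : Vector A m′) (ρ : Vector A m) → Splits (ρ′ ++ ρ) ρ′ ρ
++-Splits ρ′ ρ = lookup-++ˡ ρ′ ρ , lookup-++ʳ ρ′ ρ

∷-Splits : (f : A → B) {ρ″ : Vector B (m′ + m)} {ρ′ : Vector A m′} {ρ : Vector B m} (x : A) →
  Splits ρ″ (f ∘ ρ′) ρ → Splits (f x ∷ ρ″) (f ∘ (x ∷ ρ′)) ρ
∷-Splits f x (hˡ , hʳ) = (λ { zero → refl ; (suc i) → hˡ i }) , hʳ

module Relativization (ψ : Formula m (suc c)) where

  -- ψ(A, ρ, σ) with A the innermost class variable.
  ψ-in : ∀ m′ c′ → Formula (m′ + m) (suc (c′ + c))
  ψ-in m′ c′ = rename (m′ ↑ʳ_) (lift 1 (c′ ↑ʳ_)) ψ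

  relativize : Formula m′ c′ → Formula (m′ + m) (c′ + c)
  relativize (i ∈̇ j)  = (i ↑ˡ _) ∈̇ (j ↑ˡ _)
  relativize (i ≐ j)  = (i ↑ˡ _) ≐ (j ↑ˡ _)
  relativize (i ∈̇ᶜ k) = (i ↑ˡ _) ∈̇ᶜ (k ↑ˡ _)
  relativize ⊥̇        = ⊥̇
  relativize (φ ⇒ θ)  = relativize φ ⇒ relativize θ
  relativize (φ ∧̇ θ)  = relativize φ ∧̇ relativize θ
  relativize (φ ∨̇ θ)  = relativize φ ∨̇ relativize θ
  relativize (∀ₛ φ)   = ∀ₛ (relativize φ)
  relativize (∃ₛ φ)   = ∃ₛ (relativize φ)
  relativize {m′} {c′} (∀ᶜ φ) = ∀ᶜ (ψ-in m′ c′ ⇒ relativize φ)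
  relativize {m′} {c′} (∃ᶜ φ) = ∃ᶜ (ψ-in m′ c′ ∧̇ relativize φ)

  module _ (S : Structure) (ρ : Vector (M S) m) (σ : Vector (Cls S) c) where

    private
      𝒴 : Structure
      𝒴 = DefinedSubstructure S ψ ρ σ

    Sat-ψ-in : {ρ″ : Vector (M S) (m′ + m)} {σ″ : Vector (Cls S) (c′ + c)} →
      (∀ j → ρ″ (m′ ↑ʳ j) ≡ ρ j) → (∀ k → σ″ (c′ ↑ʳ k) ≡ σ k) →
      (A : Cls S) → Sat S ψ ρ (A ∷ σ) ⇔ Sat S (ψ-in m′ c′) ρ″ (A ∷ σ″)
    Sat-ψ-in {c′ = c′} hρ hσ A = Sat-rename S _ _ ψ hρ (lift-∷ (c′ ↑ʳ_) A hσ)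

    Sat-relativize : (φ : Formula m′ c′) {ρ′ : Vector (M S) m′} {σ′ : Vector (Cls 𝒴) c′}
      {ρ″ : Vector (M S) (m′ + m)} {σ″ : Vector (Cls S) (c′ + c)} →
      Splits ρ″ ρ′ ρ → Splits σ″ (proj₁ ∘ σ′) σ →
      Sat 𝒴 φ ρ′ σ′ ⇔ Sat S (relativize φ) ρ″ σ″
    Sat-relativize (i ∈̇ j)  (hρ , _) _ = ≡⇒⇔ (Structure._∈ₛ_ S) (sym (hρ i)) (sym (hρ j))
    Sat-relativize (i ≐ j)  (hρ , _) _ = ≡⇒⇔ _≡_ (sym (hρ i)) (sym (hρ j))
    Sat-relativize (i ∈̇ᶜ k) (hρ , _) (hσ , _) = ≡⇒⇔ (Structure._∈ᶜ_ S) (sym (hρ i)) (sym (hσ k))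
    Sat-relativize ⊥̇        hρ hσ = ⇔-refl
    Sat-relativize (φ ⇒ θ)  hρ hσ = →-cong (Sat-relativize φ hρ hσ) (Sat-relativize θ hρ hσ)
    Sat-relativize (φ ∧̇ θ)  hρ hσ = ×-cong (Sat-relativize φ hρ hσ) (Sat-relativize θ hρ hσ)
    Sat-relativize (φ ∨̇ θ)  hρ hσ = ⊎-cong (Sat-relativize φ hρ hσ) (Sat-relativize θ hρ hσ)
    Sat-relativize (∀ₛ φ)   hρ hσ = Π-cong λ x → Sat-relativize φ (∷-Splits id x hρ) hσ
    Sat-relativize (∃ₛ φ)   hρ hσ = Σ-cong λ x → Sat-relativize φ (∷-Splits id x hρ) hσ
    Sat-relativize (∀ᶜ φ)   hρ hσ = Π-restrict-cong (Sat-ψ-in (proj₂ hρ) (proj₂ hσ))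
      λ A p → Sat-relativize φ hρ (∷-Splits proj₁ (A , p) hσ)
    Sat-relativize (∃ᶜ φ)   hρ hσ = Σ-restrict-cong (Sat-ψ-in (proj₂ hρ) (proj₂ hσ))
      λ A p → Sat-relativize φ hρ (∷-Splits proj₁ (A , p) hσ)

lemma4p9 : (S : Structure) → GB S → SOR S →
    (m c : ℕ) (ψ : Formula m (suc c)) (ρ : Fin m → M S) (σ : Fin c → Cls S) →
    SOR (DefinedSubstructure S ψ ρ σ)
lemma4p9 S _ sor m c ψ ρ σ m′ c′ φ ρ′ σ′ a total =
  let (b , collected) = sor (m′ + m) (c′ + c) (relativize φ) ρ″ σ″ a
        λ x x∈a → let (y , sat) = total x x∈a in y , proj₁ (agree x y) sat
  in b , λ x x∈a → let (y , y∈b , sat) = collected x x∈a in y , y∈b , proj₂ (agree x y) sat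
  where
    open Relativization ψ

    ρ″ : Vector (M S) (m′ + m)
    ρ″ = ρ′ ++ ρ

    σ″ : Vector (Cls S) (c′ + c)
    σ″ = (proj₁ ∘ σ′) ++ σ

    agree : ∀ x y → Sat (DefinedSubstructure S ψ ρ σ) φ (y ∷ x ∷ ρ′) σ′
                  ⇔ Sat S (relativize φ) (y ∷ x ∷ ρ″) σ″
    agree x y = Sat-relativize S ρ σ φ
      (∷-Splits id y (∷-Splits id x (++-Splits ρ′ ρ))) (++-Splits (proj₁ ∘ σ′) σ)
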